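{- For all integers $L \ge 22$ and $N \ge 21$, the coefficient of $q^N$ in $H_{L,3,L}(q)$ is positive.
   Context: $(a;q)_n := (1-a)(1-aq)\cdots(1-aq^{n-1})$. For positive integers $L,s,k$, $H_{L,s,k}(q) := \frac{q^s(1-q^k)}{(q^s;q)_{L+1}} - \left(\frac{1}{(q^{s+1};q)_L}-1\right)$. -}

module Defs where

open import Data.Nat using (ℕ; zero; suc; _∸_; _≟_)
import Data.Nat as ℕ
open import Data.Integer using (ℤ; _+_; _*_; -_; _-_; 0ℤ; 1ℤ)
open import Data.List using (List; []; _∷_)
open import Relation.Nullary using (yes; no)

PS : Set
PS = ℕ → ℤ

qpow : ℕ → PS
qpow m n with m ≟ n
... | yes _ = 1ℤ
... | no  _ = 0ℤ

one : PS
one = qpow 0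

_⊕_ : PS → PS → PS
(f ⊕ g) n = f n + g n

_⊖_ : PS → PS → PS
(f ⊖ g) n = f n - g n

sumTo : (ℕ → ℤ) → ℕ → ℤ
sumTo h zero    = h zero
sumTo h (suc n) = sumTo h n + h (suc n)

_⊛_ : PS → PS → PS
(f ⊛ g) n = sumTo (λ k → f k * g (n ∸ k)) n

prodPS : ℕ → (ℕ → PS) → PS
prodPS zero    h = one
prodPS (suc n) h = prodPS n h ⊛ h n

poch : ℕ → ℕ → PS
poch s n = prodPS n (λ i → one ⊖ qpow (s ℕ.+ i))

-- Multiplicative inverse of a power series with constant term 1:
-- b_0 = 1, b_n = - Σ_{k=1}^{n} f_k b_{n-k}.
-- invList f n = [b_n, b_{n-1}, ..., b_0].
private
  conv : PS → ℕ → List ℤ → ℤ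
  conv f i []       = 0ℤ
  conv f i (b ∷ bs) = f (suc i) * b + conv f (suc i) bs

invList : PS → ℕ → List ℤ
invList f zero    = 1ℤ ∷ []
invList f (suc n) = let bs = invList f n in (- conv f 0 bs) ∷ bs

inv : PS → PS
inv f n with invList f n
... | []    = 0ℤ
... | b ∷ _ = b

-- H_{L,s,k}(q) = q^s (1 - q^k) / (q^s;q)_{L+1} - (1/(q^{s+1};q)_L - 1)
H : ℕ → ℕ → ℕ → PS
H L s k = ((qpow s ⊛ (one ⊖ qpow k)) ⊛ inv (poch s (suc L)))
          ⊖ (inv (poch (suc s) L) ⊖ one)

-- Write X_{s,n} for 1/(q^s;q)_n (invPoch s n). Splitting off the factor 1 − q^{s+L}, resp. 1 − q^s,
-- of (q^s;q)_{L+1} gives X_{s,L+1} = X_{s,L} + q^{s+L} X_{s,L+1} = X_{s+1,L} + q^s X_{s,L+1}, so for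
-- N ≥ 1 the coefficient of q^N in H_{L,s,L} is X_{s,L}(N) − 2 X_{s+1,L}(N). For s = 3, expanding
-- X_{3,L} six times and X_{4,L} once by these recursions turns it into
--   [(q³ + q⁶ + q⁹ + q¹² + q¹⁵ − 1) X_{4,L−1}](N) + X_{3,L}(N − 18) − 2 X_{4,L}(N − L − 3).
-- The last two terms have a non-negative sum for L ≥ 22, by an induction on N using that the
-- coefficients of X_{s,n} increase along steps of size s + i for i < n. The first term is at least 1
-- for N ≥ 19 and L ≥ 3: by a strong induction on N, the recursion in L reduces this to finitely
-- many coefficients, which are computed.

module Submission where

open import Defs
open import Data.Nat using (ℕ; _≤_)
open import Data.Integer using (0ℤ) renaming (_<_ to _<ℤ_)
open import Data.Nat as ℕ using (zero; suc; _∸_; _<_; z≤n; s≤s; _≟_; _≤?_; _<?_)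
import Data.Nat.Properties as ℕₚ
open ℕₚ using (allUpTo?)
import Data.Nat.Tactic.RingSolver as ℕ-Solver
open import Data.Nat.Induction using (<-rec)
open import Data.Integer as ℤ using (ℤ; _+_; _*_; -_; _-_; 1ℤ) renaming (_≤_ to _≤ℤ_)
import Data.Integer.Properties as ℤₚ
open import Data.Integer.Tactic.RingSolver using (solve-∀)
open import Algebra.Properties.AbelianGroup ℤₚ.+-0-abelianGroup using (inverseˡ-unique)
open import Data.List using (List)
open import Data.Empty using (⊥-elim)
open import Data.Unit using (tt)
open import Function using (_∘_)
open import Relation.Nullary using (yes; no; ¬_)
open import Relation.Nullary.Decidable using (toWitness; _→-dec_)
open import Relation.Binary.PropositionalEquality

sumTo-cong : ∀ {f g : ℕ → ℤ} n → (∀ i → i ≤ n → f i ≡ g i) → sumTo f n ≡ sumTo g n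
sumTo-cong zero    f≗g = f≗g 0 z≤n
sumTo-cong (suc n) f≗g =
  cong₂ _+_ (sumTo-cong n (λ i i≤n → f≗g i (ℕₚ.m≤n⇒m≤1+n i≤n))) (f≗g (suc n) ℕₚ.≤-refl)

sumTo-zero : ∀ {f : ℕ → ℤ} n → (∀ i → i ≤ n → f i ≡ 0ℤ) → sumTo f n ≡ 0ℤ
sumTo-zero zero    f≗0 = f≗0 0 z≤n
sumTo-zero (suc n) f≗0 =
  cong₂ _+_ (sumTo-zero n (λ i i≤n → f≗0 i (ℕₚ.m≤n⇒m≤1+n i≤n))) (f≗0 (suc n) ℕₚ.≤-refl)

sumTo-single : ∀ {f : ℕ → ℤ} n p → p ≤ n → (∀ i → i ≤ n → i ≢ p → f i ≡ 0ℤ) → sumTo f n ≡ f p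
sumTo-single zero p p≤0 f≗0 with ℕₚ.n≤0⇒n≡0 p≤0
... | refl = refl
sumTo-single {f} (suc n) p p≤1+n f≗0 with p ≤? n
... | yes p≤n = trans (cong₂ _+_ (sumTo-single n p p≤n (λ i i≤n → f≗0 i (ℕₚ.m≤n⇒m≤1+n i≤n)))
                                  (f≗0 (suc n) ℕₚ.≤-refl (λ 1+n≡p → ℕₚ.<⇒≱ (s≤s p≤n) (ℕₚ.≤-reflexive 1+n≡p))))
                      (ℤₚ.+-identityʳ (f p))
... | no p≰n with ℕₚ.≤-antisym p≤1+n (ℕₚ.≰⇒> p≰n)
... | refl = trans (cong (_+ f p) (sumTo-zero n (λ i i≤n → f≗0 i (ℕₚ.m≤n⇒m≤1+n i≤n) (λ { refl → ℕₚ.<-irrefl refl (s≤s i≤n) }))))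
                  (ℤₚ.+-identityˡ (f p))

sumTo-trunc : ∀ {f : ℕ → ℤ} m n → m ≤ n → (∀ i → m < i → i ≤ n → f i ≡ 0ℤ) → sumTo f n ≡ sumTo f m
sumTo-trunc m zero m≤0 f≗0 with ℕₚ.n≤0⇒n≡0 m≤0
... | refl = refl
sumTo-trunc m (suc n) m≤1+n f≗0 with m ≤? n
... | yes m≤n = trans (cong₂ _+_ (sumTo-trunc m n m≤n (λ i m<i i≤n → f≗0 i m<i (ℕₚ.m≤n⇒m≤1+n i≤n)))
                                  (f≗0 (suc n) (s≤s m≤n) ℕₚ.≤-refl))
                      (ℤₚ.+-identityʳ _)
... | no m≰n with ℕₚ.≤-antisym m≤1+n (ℕₚ.≰⇒> m≰n)
... | refl = refl

sumTo-suc-head : ∀ (f : ℕ → ℤ) n → sumTo f (suc n) ≡ f 0 + sumTo (f ∘ suc) n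
sumTo-suc-head f zero    = refl
sumTo-suc-head f (suc n) =
  trans (cong (_+ f (suc (suc n))) (sumTo-suc-head f n)) (ℤₚ.+-assoc (f 0) _ _)

sumTo-sub : ∀ (f g : ℕ → ℤ) n → sumTo (λ i → f i - g i) n ≡ sumTo f n - sumTo g n
sumTo-sub f g zero    = refl
sumTo-sub f g (suc n) =
  trans (cong (_+ (f (suc n) - g (suc n))) (sumTo-sub f g n)) (interchange (sumTo f n) (sumTo g n) (f (suc n)) (g (suc n)))
  where
  interchange : ∀ a b c d → (a - b) + (c - d) ≡ (a + c) - (b + d)
  interchange = solve-∀

shift : ℕ → PS → PS
shift d f x with d ≤? x
... | yes _ = f (x ∸ d)
... | no  _ = 0ℤ

shift-≤ : ∀ {d x} f → d ≤ x → shift d f x ≡ f (x ∸ d)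
shift-≤ {d} {x} f d≤x with d ≤? x
... | yes _   = refl
... | no  d≰x = ⊥-elim (d≰x d≤x)

shift-≰ : ∀ {d x} f → ¬ d ≤ x → shift d f x ≡ 0ℤ
shift-≰ {d} {x} f d≰x with d ≤? x
... | yes d≤x = ⊥-elim (d≰x d≤x)
... | no  _   = refl

shift-cong : ∀ d {f g} x → (d ≤ x → f (x ∸ d) ≡ g (x ∸ d)) → shift d f x ≡ shift d g x
shift-cong d x f≡g with d ≤? x
... | yes d≤x = f≡g d≤x
... | no  _   = refl

shift-zero : ∀ f x → shift 0 f x ≡ f x
shift-zero f x = shift-≤ f z≤n

shift-⊕ : ∀ d f g x → shift d (f ⊕ g) x ≡ shift d f x + shift d g x
shift-⊕ d f g x with d ≤? x
... | yes _ = refl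
... | no  _ = refl

shift-⊖ : ∀ d f g x → shift d (f ⊖ g) x ≡ shift d f x - shift d g x
shift-⊖ d f g x with d ≤? x
... | yes _ = refl
... | no  _ = refl

shift-shift : ∀ a b f x → shift b (shift a f) x ≡ shift (b ℕ.+ a) f x
shift-shift a b f x with b ≤? x | b ℕ.+ a ≤? x
... | yes b≤x | yes b+a≤x =
  trans (shift-≤ f (ℕₚ.m+n≤o⇒m≤o∸n a (subst (_≤ x) (ℕₚ.+-comm b a) b+a≤x)))
        (cong f (ℕₚ.∸-+-assoc x b a))
... | yes b≤x | no b+a≰x =
  shift-≰ f (λ a≤x∸b → b+a≰x (subst (_≤ x) (ℕₚ.+-comm a b) (ℕₚ.m≤o∸n⇒m+n≤o a b≤x a≤x∸b)))
... | no b≰x | yes b+a≤x = ⊥-elim (b≰x (ℕₚ.m+n≤o⇒m≤o b b+a≤x))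
... | no _   | no _      = refl

sumTo-shift : ∀ d g n → sumTo (shift d g) n ≡ shift d (sumTo g) n
sumTo-shift d g zero with d ≤? 0
... | yes _ rewrite ℕₚ.0∸n≡0 d = refl
... | no  _ = refl
sumTo-shift d g (suc n) with d ≤? n | d ≤? suc n
... | yes d≤n | yes _ = begin
  sumTo (shift d g) n + g (suc n ∸ d)         ≡⟨ cong₂ _+_ (trans (sumTo-shift d g n) (shift-≤ (sumTo g) d≤n))
                                                           (cong g (ℕₚ.+-∸-assoc 1 d≤n)) ⟩
  sumTo g (n ∸ d) + g (suc (n ∸ d))           ≡⟨ cong (sumTo g) (ℕₚ.+-∸-assoc 1 d≤n) ⟨
  sumTo g (suc n ∸ d)                         ∎
  where open ≡-Reasoning
... | yes d≤n | no d≰1+n = ⊥-elim (d≰1+n (ℕₚ.m≤n⇒m≤1+n d≤n))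
... | no d≰n  | yes d≤1+n with ℕₚ.≤-antisym d≤1+n (ℕₚ.≰⇒> d≰n)
...   | refl rewrite ℕₚ.n∸n≡0 (suc n) =
  trans (cong (_+ g 0) (trans (sumTo-shift (suc n) g n) (shift-≰ (sumTo g) d≰n))) (ℤₚ.+-identityˡ (g 0))
sumTo-shift d g (suc n) | no d≰n | no _ =
  cong (_+ 0ℤ) (trans (sumTo-shift d g n) (shift-≰ (sumTo g) d≰n))

shift-nonneg : ∀ d f x → 0 < d → (∀ y → y < x → 0ℤ ≤ℤ f y) → 0ℤ ≤ℤ shift d f x
shift-nonneg d f x 0<d f≥0 with d ≤? x
... | yes d≤x = f≥0 (x ∸ d) (ℕₚ.∸-monoʳ-< 0<d d≤x)
... | no  _   = ℤₚ.≤-refl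

-- f = g / (1 - q^d), in the form f = g + q^d f.
record Peels (d : ℕ) (f g : PS) : Set where
  constructor peels
  field peel : ∀ x → f x ≡ g x + shift d f x

open Peels

qpow-self : ∀ d → qpow d d ≡ 1ℤ
qpow-self d with d ≟ d
... | yes _   = refl
... | no  d≢d = ⊥-elim (d≢d refl)

qpow-≢ : ∀ {d i} → d ≢ i → qpow d i ≡ 0ℤ
qpow-≢ {d} {i} d≢i with d ≟ i
... | yes d≡i = ⊥-elim (d≢i d≡i)
... | no  _   = refl

qpow-nonneg : ∀ d i → 0ℤ ≤ℤ qpow d i
qpow-nonneg d i with d ≟ i
... | yes _ = ℤ.+≤+ z≤n
... | no  _ = ℤₚ.≤-refl

⊛-congˡ : ∀ {f g} h k → (∀ i → f i ≡ g i) → (f ⊛ h) k ≡ (g ⊛ h) k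
⊛-congˡ h k f≗g = sumTo-cong k (λ i _ → cong (_* h (k ∸ i)) (f≗g i))

⊛-congʳ : ∀ f {g h} k → (∀ i → g i ≡ h i) → (f ⊛ g) k ≡ (f ⊛ h) k
⊛-congʳ f k g≗h = sumTo-cong k (λ i _ → cong (f i *_) (g≗h (k ∸ i)))

⊛-distribˡ-⊖ : ∀ f g h k → (f ⊛ (g ⊖ h)) k ≡ (f ⊛ g) k - (f ⊛ h) k
⊛-distribˡ-⊖ f g h k =
  trans (sumTo-cong k (λ i _ → distrib (f i) (g (k ∸ i)) (h (k ∸ i)))) (sumTo-sub _ _ k)
  where
  distrib : ∀ a b c → a * (b - c) ≡ a * b - a * c
  distrib = solve-∀

⊛-distribʳ-⊖ : ∀ f g h k → ((f ⊖ g) ⊛ h) k ≡ (f ⊛ h) k - (g ⊛ h) k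
⊛-distribʳ-⊖ f g h k =
  trans (sumTo-cong k (λ i _ → distrib (f i) (g i) (h (k ∸ i)))) (sumTo-sub _ _ k)
  where
  distrib : ∀ a b c → (a - b) * c ≡ a * c - b * c
  distrib = solve-∀

qpow-⊛ : ∀ d f k → (qpow d ⊛ f) k ≡ shift d f k
qpow-⊛ d f k with d ≤? k
... | yes d≤k =
  trans (sumTo-single k d d≤k (λ i _ i≢d → cong (_* f (k ∸ i)) (qpow-≢ {d} {i} (i≢d ∘ sym))))
        (trans (cong (_* f (k ∸ d)) (qpow-self d)) (ℤₚ.*-identityˡ (f (k ∸ d))))
... | no d≰k =
  sumTo-zero k (λ i i≤k → cong (_* f (k ∸ i)) (qpow-≢ {d} {i} (λ { refl → d≰k i≤k })))

⊛-qpow : ∀ d f k → (f ⊛ qpow d) k ≡ shift d f k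
⊛-qpow d f k with d ≤? k
... | yes d≤k =
  trans (sumTo-single k (k ∸ d) (ℕₚ.m∸n≤m k d) vanish)
        (trans (cong (f (k ∸ d) *_) (trans (cong (qpow d) (ℕₚ.m∸[m∸n]≡n d≤k)) (qpow-self d)))
               (ℤₚ.*-identityʳ (f (k ∸ d))))
  where
  vanish : ∀ i → i ≤ k → i ≢ k ∸ d → f i * qpow d (k ∸ i) ≡ 0ℤ
  vanish i i≤k i≢k∸d = trans (cong (f i *_) (qpow-≢ λ d≡k∸i →
      i≢k∸d (trans (sym (ℕₚ.m∸[m∸n]≡n i≤k)) (cong (k ∸_) (sym d≡k∸i)))))
    (ℤₚ.*-zeroʳ (f i))
... | no d≰k =
  sumTo-zero k (λ i _ → trans (cong (f i *_) (qpow-≢ (λ { refl → d≰k (ℕₚ.m∸n≤m k i) })))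
                              (ℤₚ.*-zeroʳ (f i)))

⊛-one-minus-qpow : ∀ d f k → (f ⊛ (one ⊖ qpow d)) k ≡ f k - shift d f k
⊛-one-minus-qpow d f k = trans (⊛-distribˡ-⊖ f one (qpow d) k)
  (cong₂ _-_ (trans (⊛-qpow 0 f k) (shift-zero f k)) (⊛-qpow d f k))

one-minus-qpow-⊛ : ∀ d f k → ((one ⊖ qpow d) ⊛ f) k ≡ f k - shift d f k
one-minus-qpow-⊛ d f k = trans (⊛-distribʳ-⊖ one (qpow d) f k)
  (cong₂ _-_ (trans (qpow-⊛ 0 f k) (shift-zero f k)) (qpow-⊛ d f k))

shift-⊛ : ∀ d f g k → (shift d f ⊛ g) k ≡ shift d (f ⊛ g) k
shift-⊛ d f g k = trans (sumTo-cong k termwise) (trans (sumTo-shift d h k) (shift-cong d k (λ _ → refl)))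
  where
  h : ℕ → ℤ
  h j = f j * g ((k ∸ d) ∸ j)
  termwise : ∀ i → i ≤ k → shift d f i * g (k ∸ i) ≡ shift d h i
  termwise i _ with d ≤? i
  ... | yes d≤i = cong (λ j → f (i ∸ d) * g j)
                       (trans (cong (k ∸_) (sym (ℕₚ.m+[n∸m]≡n d≤i))) (sym (ℕₚ.∸-+-assoc k d (i ∸ d))))
  ... | no  _   = refl

⊛-shift : ∀ d f g k → (f ⊛ shift d g) k ≡ shift d (f ⊛ g) k
⊛-shift d f g k with d ≤? k
... | yes d≤k = trans (sumTo-trunc (k ∸ d) k (ℕₚ.m∸n≤m k d) vanish) (sumTo-cong (k ∸ d) termwise)
  where
  vanish : ∀ i → k ∸ d < i → i ≤ k → f i * shift d g (k ∸ i) ≡ 0ℤ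
  vanish i k∸d<i i≤k = trans (cong (f i *_) (shift-≰ g λ d≤k∸i →
      ℕₚ.<⇒≱ k∸d<i (ℕₚ.m+n≤o⇒m≤o∸n i (subst (_≤ k) (ℕₚ.+-comm d i) (ℕₚ.m≤o∸n⇒m+n≤o d i≤k d≤k∸i)))))
    (ℤₚ.*-zeroʳ (f i))
  termwise : ∀ i → i ≤ k ∸ d → f i * shift d g (k ∸ i) ≡ f i * g ((k ∸ d) ∸ i)
  termwise i i≤k∸d = cong (f i *_) (trans (shift-≤ g d≤k∸i) (cong g
      (trans (ℕₚ.∸-+-assoc k i d) (trans (cong (k ∸_) (ℕₚ.+-comm i d)) (sym (ℕₚ.∸-+-assoc k d i))))))
    where
    d≤k∸i : d ≤ k ∸ i
    d≤k∸i = ℕₚ.m+n≤o⇒m≤o∸n d (subst (_≤ k) (ℕₚ.+-comm i d) (ℕₚ.m≤o∸n⇒m+n≤o i d≤k i≤k∸d))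
... | no d≰k = sumTo-zero k (λ i _ → trans
  (cong (f i *_) (shift-≰ g (λ d≤k∸i → d≰k (ℕₚ.≤-trans d≤k∸i (ℕₚ.m∸n≤m k i))))) (ℤₚ.*-zeroʳ (f i)))

⊛-assoc-one-minus-qpow : ∀ d f g k → ((f ⊛ (one ⊖ qpow d)) ⊛ g) k ≡ (f ⊛ ((one ⊖ qpow d) ⊛ g)) k
⊛-assoc-one-minus-qpow d f g k = begin
  ((f ⊛ (one ⊖ qpow d)) ⊛ g) k        ≡⟨ ⊛-congˡ g k (⊛-one-minus-qpow d f) ⟩
  ((f ⊖ shift d f) ⊛ g) k             ≡⟨ ⊛-distribʳ-⊖ f (shift d f) g k ⟩
  (f ⊛ g) k - (shift d f ⊛ g) k       ≡⟨ cong (λ x → (f ⊛ g) k - x) (trans (shift-⊛ d f g k) (sym (⊛-shift d f g k))) ⟩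
  (f ⊛ g) k - (f ⊛ shift d g) k       ≡⟨ ⊛-distribˡ-⊖ f g (shift d g) k ⟨
  (f ⊛ (g ⊖ shift d g)) k             ≡⟨ ⊛-congʳ f k (one-minus-qpow-⊛ d g) ⟨
  (f ⊛ ((one ⊖ qpow d) ⊛ g)) k        ∎
  where open ≡-Reasoning

-- `conv` is private to Defs; abstracting its arguments turns the defining
-- clause of `inv` into a pattern unification problem that recovers it.
mutual
  conv : PS → ℕ → List ℤ → ℤ
  conv h = _

  inv-suc-conv : ∀ h n → inv h (suc n) ≡ - conv h 0 (invList h n)
  inv-suc-conv h n with invList h n | 0
  ... | _ | _ = refl

conv-invList : ∀ h n i → conv h i (invList h n) ≡ sumTo (λ t → h (suc (i ℕ.+ t)) * inv h (n ∸ t)) n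
conv-invList h zero i =
  trans (ℤₚ.+-identityʳ (h (suc i) * 1ℤ)) (cong (λ j → h (suc j) * 1ℤ) (sym (ℕₚ.+-identityʳ i)))
conv-invList h (suc n) i = begin
  h (suc i) * inv h (suc n) + conv h (suc i) (invList h n)
    ≡⟨ cong₂ _+_ (cong (λ j → h (suc j) * inv h (suc n)) (sym (ℕₚ.+-identityʳ i)))
                 (trans (conv-invList h n (suc i))
                        (sumTo-cong n (λ t _ → cong (λ j → h (suc j) * inv h (n ∸ t)) (sym (ℕₚ.+-suc i t))))) ⟩
  h (suc (i ℕ.+ 0)) * inv h (suc n) + sumTo (λ t → h (suc (i ℕ.+ suc t)) * inv h (n ∸ t)) n
    ≡⟨ sumTo-suc-head (λ t → h (suc (i ℕ.+ t)) * inv h (suc n ∸ t)) n ⟨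
  sumTo (λ t → h (suc (i ℕ.+ t)) * inv h (suc n ∸ t)) (suc n) ∎
  where open ≡-Reasoning

inv-suc : ∀ h n → inv h (suc n) ≡ - sumTo (λ t → h (suc t) * inv h (n ∸ t)) n
inv-suc h n = trans (inv-suc-conv h n) (cong -_ (conv-invList h n 0))

convolve-head : ∀ h W n → h 0 ≡ 1ℤ →
                (h ⊛ W) (suc n) ≡ W (suc n) + sumTo (λ t → h (suc t) * W (n ∸ t)) n
convolve-head h W n h₀≡1 = trans (sumTo-suc-head (λ k → h k * W (suc n ∸ k)) n)
  (cong (_+ sumTo (λ t → h (suc t) * W (n ∸ t)) n) (trans (cong (_* W (suc n)) h₀≡1) (ℤₚ.*-identityˡ (W (suc n)))))

⊛-inv : ∀ h → h 0 ≡ 1ℤ → ∀ n → (h ⊛ inv h) n ≡ one n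
⊛-inv h h₀≡1 zero    = cong (_* 1ℤ) h₀≡1
⊛-inv h h₀≡1 (suc n) = trans (convolve-head h (inv h) n h₀≡1)
  (trans (cong (_+ S) (inv-suc h n)) (ℤₚ.+-inverseˡ S))
  where
  S : ℤ
  S = sumTo (λ t → h (suc t) * inv h (n ∸ t)) n

inv-unique : ∀ h W → h 0 ≡ 1ℤ → (∀ n → (h ⊛ W) n ≡ one n) → ∀ n → W n ≡ inv h n
inv-unique h W h₀≡1 h⊛W≗1 = <-rec (λ n → W n ≡ inv h n) step
  where
  step : ∀ n → (∀ {m} → m < n → W m ≡ inv h m) → W n ≡ inv h n
  step zero    _  = trans (sym (ℤₚ.*-identityˡ (W 0))) (trans (cong (_* W 0) (sym h₀≡1)) (h⊛W≗1 0))
  step (suc n) ih = begin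
    W (suc n)                                        ≡⟨ inverseˡ-unique (W (suc n)) (sumTo (λ t → h (suc t) * W (n ∸ t)) n)
                                                          (trans (sym (convolve-head h W n h₀≡1)) (h⊛W≗1 (suc n))) ⟩
    - sumTo (λ t → h (suc t) * W (n ∸ t)) n          ≡⟨ cong -_ (sumTo-cong n (λ t _ → cong (h (suc t) *_) (ih (s≤s (ℕₚ.m∸n≤m n t))))) ⟩
    - sumTo (λ t → h (suc t) * inv h (n ∸ t)) n      ≡⟨ inv-suc h n ⟨
    inv h (suc n)                                    ∎
    where open ≡-Reasoning

⊛-one-minus-qpow-comm : ∀ a b f k →
  ((f ⊛ (one ⊖ qpow a)) ⊛ (one ⊖ qpow b)) k ≡ ((f ⊛ (one ⊖ qpow b)) ⊛ (one ⊖ qpow a)) k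
⊛-one-minus-qpow-comm a b f k = begin
  ((f ⊛ (one ⊖ qpow a)) ⊛ (one ⊖ qpow b)) k              ≡⟨ expand a b ⟩
  f k - shift a f k - shift b f k + shift (b ℕ.+ a) f k  ≡⟨ swap (f k) (shift a f k) (shift b f k) _ ⟩
  f k - shift b f k - shift a f k + shift (b ℕ.+ a) f k  ≡⟨ cong (λ c → f k - shift b f k - shift a f k + shift c f k) (ℕₚ.+-comm b a) ⟩
  f k - shift b f k - shift a f k + shift (a ℕ.+ b) f k  ≡⟨ expand b a ⟨
  ((f ⊛ (one ⊖ qpow b)) ⊛ (one ⊖ qpow a)) k              ∎
  where
  open ≡-Reasoning
  expand : ∀ a b → ((f ⊛ (one ⊖ qpow a)) ⊛ (one ⊖ qpow b)) k
                   ≡ f k - shift a f k - shift b f k + shift (b ℕ.+ a) f k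
  expand a b = begin
    ((f ⊛ (one ⊖ qpow a)) ⊛ (one ⊖ qpow b)) k
      ≡⟨ ⊛-one-minus-qpow b (f ⊛ (one ⊖ qpow a)) k ⟩
    (f ⊛ (one ⊖ qpow a)) k - shift b (f ⊛ (one ⊖ qpow a)) k
      ≡⟨ cong₂ _-_ (⊛-one-minus-qpow a f k) (trans (shift-cong b k (λ _ → ⊛-one-minus-qpow a f (k ∸ b)))
                                                   (shift-⊖ b f (shift a f) k)) ⟩
    (f k - shift a f k) - (shift b f k - shift b (shift a f) k)
      ≡⟨ cong (λ z → (f k - shift a f k) - (shift b f k - z)) (shift-shift a b f k) ⟩
    (f k - shift a f k) - (shift b f k - shift (b ℕ.+ a) f k)
      ≡⟨ regroup (f k) (shift a f k) (shift b f k) (shift (b ℕ.+ a) f k) ⟩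
    f k - shift a f k - shift b f k + shift (b ℕ.+ a) f k ∎
    where
    regroup : ∀ x y z w → (x - y) - (z - w) ≡ x - y - z + w
    regroup = solve-∀
  swap : ∀ x y z w → x - y - z + w ≡ x - z - y + w
  swap = solve-∀

poch-suc-first : ∀ s n k → (poch (suc s) n ⊛ (one ⊖ qpow s)) k ≡ poch s (suc n) k
poch-suc-first s zero    k = ⊛-congʳ one k (λ i → cong (λ c → (one ⊖ qpow c) i) (sym (ℕₚ.+-identityʳ s)))
poch-suc-first s (suc n) k = begin
  ((poch (suc s) n ⊛ (one ⊖ qpow (suc s ℕ.+ n))) ⊛ (one ⊖ qpow s)) k
    ≡⟨ ⊛-one-minus-qpow-comm (suc s ℕ.+ n) s (poch (suc s) n) k ⟩
  ((poch (suc s) n ⊛ (one ⊖ qpow s)) ⊛ (one ⊖ qpow (suc s ℕ.+ n))) k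
    ≡⟨ ⊛-congˡ (one ⊖ qpow (suc s ℕ.+ n)) k (poch-suc-first s n) ⟩
  (poch s (suc n) ⊛ (one ⊖ qpow (suc s ℕ.+ n))) k
    ≡⟨ ⊛-congʳ (poch s (suc n)) k (λ i → cong (λ c → (one ⊖ qpow c) i) (sym (ℕₚ.+-suc s n))) ⟩
  poch s (suc (suc n)) k ∎
  where open ≡-Reasoning

poch-const : ∀ s n → poch (suc s) n 0 ≡ 1ℤ
poch-const s zero    = refl
poch-const s (suc n) = cong (_* 1ℤ) (poch-const s n)

inv-peel-factor : ∀ f g d → f 0 ≡ 1ℤ → g 0 ≡ 1ℤ → (∀ k → (f ⊛ (one ⊖ qpow d)) k ≡ g k) →
                  Peels d (inv g) (inv f)
inv-peel-factor f g d f₀≡1 g₀≡1 f[1-qᵈ]≗g = peels λ k → begin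
  inv g k                                   ≡⟨ split (inv g k) (shift d (inv g) k) ⟩
  (inv g k - shift d (inv g) k) + shift d (inv g) k
    ≡⟨ cong (_+ shift d (inv g) k) (trans (sym (one-minus-qpow-⊛ d (inv g) k)) (inv-unique f W f₀≡1 f⊛W≗1 k)) ⟩
  inv f k + shift d (inv g) k               ∎
  where
  open ≡-Reasoning
  W : PS
  W = (one ⊖ qpow d) ⊛ inv g
  f⊛W≗1 : ∀ j → (f ⊛ W) j ≡ one j
  f⊛W≗1 j = trans (sym (⊛-assoc-one-minus-qpow d f (inv g) j))
                  (trans (⊛-congˡ (inv g) j f[1-qᵈ]≗g) (⊛-inv g g₀≡1 j))
  split : ∀ x y → x ≡ (x - y) + y
  split = solve-∀

-- Opaque, so that unification never unfolds the inverse of a Pochhammer product.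
opaque
  invPoch : ℕ → ℕ → PS
  invPoch s n = inv (poch s n)

  invPoch-inv : ∀ s n k → invPoch s n k ≡ inv (poch s n) k
  invPoch-inv s n k = refl

  invPoch-zero : ∀ s k → invPoch s 0 k ≡ one k
  invPoch-zero s k = sym (inv-unique one one refl (λ j → trans (qpow-⊛ 0 one j) (shift-zero one j)) k)

  invPoch-peel-last : ∀ s n → Peels (suc s ℕ.+ n) (invPoch (suc s) (suc n)) (invPoch (suc s) n)
  invPoch-peel-last s n = inv-peel-factor (poch (suc s) n) (poch (suc s) (suc n)) (suc s ℕ.+ n)
    (poch-const s n) (poch-const s (suc n)) (λ _ → refl)

  invPoch-peel-first : ∀ s n → Peels (suc s) (invPoch (suc s) (suc n)) (invPoch (suc (suc s)) n)
  invPoch-peel-first s n = inv-peel-factor (poch (suc (suc s)) n) (poch (suc s) (suc n)) (suc s)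
    (poch-const (suc s) n) (poch-const s (suc n)) (poch-suc-first (suc s) n)

invPoch-nonneg : ∀ s n k → 0ℤ ≤ℤ invPoch (suc s) n k
invPoch-nonneg s zero    k = subst (0ℤ ≤ℤ_) (sym (invPoch-zero (suc s) k)) (qpow-nonneg 0 k)
invPoch-nonneg s (suc n) = <-rec (λ k → 0ℤ ≤ℤ invPoch (suc s) (suc n) k) λ k ih →
  subst (0ℤ ≤ℤ_) (sym (peel (invPoch-peel-last s n) k))
        (ℤₚ.+-mono-≤ (invPoch-nonneg s n k) (shift-nonneg (suc s ℕ.+ n) _ k (s≤s z≤n) (λ _ → ih)))

shift-mono : ∀ d e f k → 0 < d → (∀ y → 0ℤ ≤ℤ f y) → (∀ y → y < k → f y ≤ℤ f (e ℕ.+ y)) →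
             shift d f k ≤ℤ shift d f (e ℕ.+ k)
shift-mono d e f k 0<d f≥0 f↗ with d ≤? k
... | yes d≤k = subst (f (k ∸ d) ≤ℤ_)
                  (trans (cong f (sym (ℕₚ.+-∸-assoc e d≤k))) (sym (shift-≤ f (ℕₚ.≤-trans d≤k (ℕₚ.m≤n+m k e)))))
                  (f↗ (k ∸ d) (ℕₚ.∸-monoʳ-< 0<d d≤k))
... | no _ = shift-nonneg d f (e ℕ.+ k) 0<d (λ y _ → f≥0 y)

invPoch-mono-step : ∀ s n i k → i < n → invPoch (suc s) n k ≤ℤ invPoch (suc s) n ((suc s ℕ.+ i) ℕ.+ k)
invPoch-mono-step s (suc n) i k i<1+n = <-rec P step k
  where
  X : PS
  X = invPoch (suc s) (suc n)
  P : ℕ → Set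
  P k = X k ≤ℤ X ((suc s ℕ.+ i) ℕ.+ k)
  step : ∀ k → (∀ {y} → y < k → P y) → P k
  step k ih with i ≟ n
  ... | yes refl = begin
    X k                                 ≡⟨ ℤₚ.+-identityˡ (X k) ⟨
    0ℤ + X k                            ≤⟨ ℤₚ.+-monoˡ-≤ (X k) (invPoch-nonneg s i (e ℕ.+ k)) ⟩
    invPoch (suc s) i (e ℕ.+ k) + X k   ≡⟨ cong (invPoch (suc s) i (e ℕ.+ k) +_) shift-X ⟨
    invPoch (suc s) i (e ℕ.+ k) + shift e X (e ℕ.+ k)
                                        ≡⟨ peel (invPoch-peel-last s i) (e ℕ.+ k) ⟨
    X (e ℕ.+ k)                         ∎
    where
    open ℤₚ.≤-Reasoning
    e : ℕ
    e = suc s ℕ.+ i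
    shift-X : shift e X (e ℕ.+ k) ≡ X k
    shift-X = trans (shift-≤ X (ℕₚ.m≤m+n e k)) (cong X (ℕₚ.m+n∸m≡n e k))
  ... | no i≢n = subst₂ _≤ℤ_ (sym (peel (invPoch-peel-last s n) k)) (sym (peel (invPoch-peel-last s n) _))
                   (ℤₚ.+-mono-≤ (invPoch-mono-step s n i k (ℕₚ.≤∧≢⇒< (ℕₚ.≤-pred i<1+n) i≢n))
                                (shift-mono (suc s ℕ.+ n) (suc s ℕ.+ i) X k (s≤s z≤n) (invPoch-nonneg s (suc n)) (λ y → ih)))

H-coeff : ∀ L s N → 0 < s →
          H L s L (suc N) ≡ invPoch s L (suc N) - (invPoch (suc s) L (suc N) + invPoch (suc s) L (suc N))
H-coeff L (suc s) N _ = begin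
  ((qpow S ⊛ (one ⊖ qpow L)) ⊛ inv (poch S (suc L))) (suc N) - (inv (poch (suc S) L) (suc N) - 0ℤ)
    ≡⟨ cong₂ (λ a b → a - (b - 0ℤ)) first-term (sym (invPoch-inv (suc S) L (suc N))) ⟩
  (shift S X (suc N) - shift (L ℕ.+ S) X (suc N)) - (Y - 0ℤ)
    ≡⟨ cong (λ c → (shift S X (suc N) - shift c X (suc N)) - (Y - 0ℤ)) (ℕₚ.+-comm L S) ⟩
  (shift S X (suc N) - shift (S ℕ.+ L) X (suc N)) - (Y - 0ℤ)
    ≡⟨ eliminate (X (suc N)) Y (invPoch S L (suc N)) _ _
                 (peel (invPoch-peel-first s L) (suc N)) (peel (invPoch-peel-last s L) (suc N)) ⟩
  invPoch S L (suc N) - (Y + Y) ∎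
  where
  open ≡-Reasoning
  S : ℕ
  S = suc s
  X : PS
  X = invPoch S (suc L)
  Y : ℤ
  Y = invPoch (suc S) L (suc N)
  first-term : ((qpow S ⊛ (one ⊖ qpow L)) ⊛ inv (poch S (suc L))) (suc N) ≡ shift S X (suc N) - shift (L ℕ.+ S) X (suc N)
  first-term = begin
    ((qpow S ⊛ (one ⊖ qpow L)) ⊛ inv (poch S (suc L))) (suc N)
      ≡⟨ ⊛-congʳ (qpow S ⊛ (one ⊖ qpow L)) (suc N) (λ k → sym (invPoch-inv S (suc L) k)) ⟩
    ((qpow S ⊛ (one ⊖ qpow L)) ⊛ X) (suc N)
      ≡⟨ ⊛-congˡ X (suc N) (⊛-one-minus-qpow L (qpow S)) ⟩
    ((qpow S ⊖ shift L (qpow S)) ⊛ X) (suc N)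
      ≡⟨ ⊛-distribʳ-⊖ (qpow S) (shift L (qpow S)) X (suc N) ⟩
    (qpow S ⊛ X) (suc N) - (shift L (qpow S) ⊛ X) (suc N)
      ≡⟨ cong₂ _-_ (qpow-⊛ S X (suc N))
                   (trans (shift-⊛ L (qpow S) X (suc N))
                          (trans (shift-cong L (suc N) (λ _ → qpow-⊛ S X (suc N ∸ L))) (shift-shift S L X (suc N)))) ⟩
    shift S X (suc N) - shift (L ℕ.+ S) X (suc N) ∎
  eliminate : ∀ x y f b c → x ≡ y + b → x ≡ f + c → (b - c) - (y - 0ℤ) ≡ f - (y + y)
  eliminate x y f b c x≡y+b x≡f+c = begin
    (b - c) - (y - 0ℤ)                        ≡⟨ regroup y f b c ⟩
    ((y + b) - (f + c)) + (f - (y + y))       ≡⟨ cong (λ z → (z - (f + c)) + (f - (y + y))) (trans (sym x≡y+b) x≡f+c) ⟩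
    ((f + c) - (f + c)) + (f - (y + y))       ≡⟨ cong (_+ (f - (y + y))) (ℤₚ.+-inverseʳ (f + c)) ⟩
    0ℤ + (f - (y + y))                        ≡⟨ ℤₚ.+-identityˡ _ ⟩
    f - (y + y)                               ∎
    where
    regroup : ∀ y f b c → (b - c) - (y - 0ℤ) ≡ ((y + b) - (f + c)) + (f - (y + y))
    regroup = solve-∀

peels-below : ∀ {d f g x} → Peels d f g → x < d → f x ≡ g x
peels-below {d} {f} {g} {x} (peels f≡g+qᵈf) x<d =
  trans (f≡g+qᵈf x) (trans (cong (g x +_) (shift-≰ f (ℕₚ.<⇒≱ x<d))) (ℤₚ.+-identityʳ (g x)))

peels-shift : ∀ c {d f g} → Peels d f g → Peels d (shift c f) (shift c g)
peels-shift c {d} {f} {g} (peels f≡g+qᵈf) = peels λ x → begin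
  shift c f x                            ≡⟨ shift-cong c x (λ _ → f≡g+qᵈf (x ∸ c)) ⟩
  shift c (g ⊕ shift d f) x              ≡⟨ shift-⊕ c g (shift d f) x ⟩
  shift c g x + shift c (shift d f) x    ≡⟨ cong (shift c g x +_) (shift-shift d c f x) ⟩
  shift c g x + shift (c ℕ.+ d) f x      ≡⟨ cong (λ e → shift c g x + shift e f x) (ℕₚ.+-comm c d) ⟩
  shift c g x + shift (d ℕ.+ c) f x      ≡⟨ cong (shift c g x +_) (shift-shift c d f x) ⟨
  shift c g x + shift d (shift c f) x    ∎
  where open ≡-Reasoning

peels-⊕ : ∀ {d f₁ f₂ g₁ g₂} → Peels d f₁ g₁ → Peels d f₂ g₂ → Peels d (f₁ ⊕ f₂) (g₁ ⊕ g₂)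
peels-⊕ {d} {f₁} {f₂} {g₁} {g₂} (peels p₁) (peels p₂) = peels λ x →
  trans (cong₂ _+_ (p₁ x) (p₂ x))
        (trans (interchange (g₁ x) (shift d f₁ x) (g₂ x) (shift d f₂ x))
               (cong (g₁ x + g₂ x +_) (sym (shift-⊕ d f₁ f₂ x))))
  where
  interchange : ∀ a b c e → (a + b) + (c + e) ≡ (a + c) + (b + e)
  interchange = solve-∀

peels-⊖ : ∀ {d f₁ f₂ g₁ g₂} → Peels d f₁ g₁ → Peels d f₂ g₂ → Peels d (f₁ ⊖ f₂) (g₁ ⊖ g₂)
peels-⊖ {d} {f₁} {f₂} {g₁} {g₂} (peels p₁) (peels p₂) = peels λ x →
  trans (cong₂ _-_ (p₁ x) (p₂ x))
        (trans (interchange (g₁ x) (shift d f₁ x) (g₂ x) (shift d f₂ x))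
               (cong (g₁ x - g₂ x +_) (sym (shift-⊖ d f₁ f₂ x))))
  where
  interchange : ∀ a b c e → (a + b) - (c + e) ≡ (a - c) + (b - e)
  interchange = solve-∀

combo : PS → PS
combo f = ((((shift 3 f ⊕ shift 6 f) ⊕ shift 9 f) ⊕ shift 12 f) ⊕ shift 15 f) ⊖ f

peels-combo : ∀ {d f g} → Peels d f g → Peels d (combo f) (combo g)
peels-combo p =
  peels-⊖ (peels-⊕ (peels-⊕ (peels-⊕ (peels-⊕ (peels-shift 3 p) (peels-shift 6 p)) (peels-shift 9 p))
                            (peels-shift 12 p)) (peels-shift 15 p)) p

combo-cong : ∀ {f g} x → (∀ y → y ≤ x → f y ≡ g y) → combo f x ≡ combo g x
combo-cong {f} {g} x f≗g =
  cong₂ _-_ (cong₂ _+_ (cong₂ _+_ (cong₂ _+_ (cong₂ _+_ (shifted 3) (shifted 6)) (shifted 9)) (shifted 12)) (shifted 15))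
            (f≗g x ℕₚ.≤-refl)
  where
  shifted : ∀ c → shift c f x ≡ shift c g x
  shifted c = shift-cong c x (λ _ → f≗g (x ∸ c) (ℕₚ.m∸n≤m x c))

C : ℕ → PS
C n = combo (invPoch 4 n)

C-peels : ∀ n → Peels (4 ℕ.+ n) (C (suc n)) (C n)
C-peels n = peels-combo (invPoch-peel-last 3 n)

C-stable : ∀ m n x → m ≤ n → x < 4 ℕ.+ m → C n x ≡ C m x
C-stable m zero    x m≤0   _     with ℕₚ.n≤0⇒n≡0 m≤0
... | refl = refl
C-stable m (suc n) x m≤1+n x<4+m with m ≤? n
... | yes m≤n = trans (peels-below (C-peels n) (ℕₚ.<-≤-trans x<4+m (ℕₚ.+-monoʳ-≤ 4 m≤n))) (C-stable m n x m≤n x<4+m)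
... | no m≰n with ℕₚ.≤-antisym m≤1+n (ℕₚ.≰⇒> m≰n)
...   | refl = refl

C-zero : ∀ x → 16 ≤ x → C 0 x ≡ 0ℤ
C-zero x 16≤x = subst (λ z → C 0 z ≡ 0ℤ) (ℕₚ.m+[n∸m]≡n 16≤x)
                      (combo-cong (16 ℕ.+ (x ∸ 16)) (λ y _ → invPoch-zero 4 y))

fastInvPoch : ℕ → ℕ → ℕ → PS
fastInvPoch s fuel       zero    x = one x
fastInvPoch s zero       (suc n) x = 0ℤ
fastInvPoch s (suc fuel) (suc n) x =
  fastInvPoch s (suc fuel) n x + shift (s ℕ.+ n) (fastInvPoch s fuel (suc n)) x

invPoch≡fastInvPoch : ∀ s fuel n x → x < fuel → invPoch (suc s) n x ≡ fastInvPoch (suc s) fuel n x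
invPoch≡fastInvPoch s fuel       zero    x _ = invPoch-zero (suc s) x
invPoch≡fastInvPoch s (suc fuel) (suc n) x (s≤s x≤fuel) =
  trans (peel (invPoch-peel-last s n) x)
        (cong₂ _+_ (invPoch≡fastInvPoch s (suc fuel) n x (s≤s x≤fuel))
                   (shift-cong (suc s ℕ.+ n) x λ d≤x →
                      invPoch≡fastInvPoch s fuel (suc n) _ (ℕₚ.<-≤-trans (ℕₚ.∸-monoʳ-< (s≤s z≤n) d≤x) x≤fuel)))

fastC : ℕ → PS
fastC n = combo (fastInvPoch 4 30 n)

C≡fastC : ∀ n x → x < 30 → C n x ≡ fastC n x
C≡fastC n x x<30 = combo-cong x (λ y y≤x → invPoch≡fastInvPoch 3 30 n y (ℕₚ.≤-<-trans y≤x x<30))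

-- For x ≤ 18, bound x is the minimum of C n x over n ≥ 2.
bound : ℕ → ℤ
bound 0  = - 1ℤ
bound 1  = 0ℤ
bound 2  = 0ℤ
bound 3  = 1ℤ
bound 4  = - 1ℤ
bound 5  = - 1ℤ
bound 6  = 0ℤ
bound 7  = 0ℤ
bound 8  = - 1ℤ
bound 9  = 0ℤ
bound 10 = - 1ℤ
bound 11 = 0ℤ
bound 12 = - 1ℤ
bound 13 = 0ℤ
bound 14 = - 1ℤ
bound 15 = 1ℤ
bound 16 = - 1ℤ
bound 17 = 1ℤ
bound 18 = 0ℤ
bound _  = 1ℤ

bound-one : ∀ x → 19 ≤ x → bound x ≡ 1ℤ
bound-one x 19≤x = subst (λ z → bound z ≡ 1ℤ) (ℕₚ.m+[n∸m]≡n 19≤x) refl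

bound-nonneg : ∀ x → 17 ≤ x → 0ℤ ≤ℤ bound x
bound-nonneg x 17≤x = subst (λ z → 0ℤ ≤ℤ bound z) (ℕₚ.m+[n∸m]≡n 17≤x) (beyond16 (x ∸ 17))
  where
  beyond16 : ∀ u → 0ℤ ≤ℤ bound (17 ℕ.+ u)
  beyond16 zero          = ℤ.+≤+ z≤n
  beyond16 (suc zero)    = ℤ.+≤+ z≤n
  beyond16 (suc (suc _)) = ℤ.+≤+ z≤n

boundSum : ℕ → ℕ → ℤ
boundSum zero    y = 0ℤ
boundSum (suc k) y = bound y + boundSum k (suc y)

bound≤fastC : ∀ {n} → n < 27 → 2 ≤ n → ∀ {x} → x < 30 → bound x ≤ℤ fastC n x
bound≤fastC = toWitness {a? = allUpTo? (λ n → 2 ≤? n →-dec allUpTo? (λ x → bound x ℤₚ.≤? fastC n x) 30) 27} tt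

fastC₁-nonneg : ∀ {x} → x < 20 → 16 ≤ x → 0ℤ ≤ℤ fastC 1 x
fastC₁-nonneg = toWitness {a? = allUpTo? (λ x → 16 ≤? x →-dec 0ℤ ℤₚ.≤? fastC 1 x) 20} tt

boundSum-pos : ∀ {y} → y < 17 → 1ℤ ≤ℤ boundSum (26 ∸ y) y
boundSum-pos = toWitness {a? = allUpTo? (λ y → 1ℤ ℤₚ.≤? boundSum (26 ∸ y) y) 17} tt

C₁-nonneg : ∀ x → 16 ≤ x → 0ℤ ≤ℤ C 1 x
C₁-nonneg = <-rec (λ x → 16 ≤ x → 0ℤ ≤ℤ C 1 x) step
  where
  step : ∀ x → (∀ {y} → y < x → 16 ≤ y → 0ℤ ≤ℤ C 1 y) → 16 ≤ x → 0ℤ ≤ℤ C 1 x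
  step x ih 16≤x with x <? 20
  ... | yes x<20 = subst (0ℤ ≤ℤ_) (sym (C≡fastC 1 x (ℕₚ.≤-trans x<20 (ℕₚ.m≤m+n 20 10)))) (fastC₁-nonneg x<20 16≤x)
  ... | no  x≮20 = subst (0ℤ ≤ℤ_) (sym (begin
      C 1 x                       ≡⟨ peel (C-peels 0) x ⟩
      C 0 x + shift 4 (C 1) x     ≡⟨ cong₂ _+_ (C-zero x 16≤x) (shift-≤ (C 1) 4≤x) ⟩
      0ℤ + C 1 (x ∸ 4)            ≡⟨ ℤₚ.+-identityˡ _ ⟩
      C 1 (x ∸ 4)                 ∎))
    (ih (ℕₚ.∸-monoʳ-< (s≤s z≤n) 4≤x) (ℕₚ.m+n≤o⇒m≤o∸n 16 20≤x))
    where
    open ≡-Reasoning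
    20≤x : 20 ≤ x
    20≤x = ℕₚ.≮⇒≥ x≮20
    4≤x : 4 ≤ x
    4≤x = ℕₚ.≤-trans (ℕₚ.m≤m+n 4 16) 20≤x

bound≤C-small : ∀ x n → x < 30 → 2 ≤ n → bound x ≤ℤ C n x
bound≤C-small x n x<30 2≤n with n <? 27
... | yes n<27 = subst (bound x ≤ℤ_) (sym (C≡fastC n x x<30)) (bound≤fastC n<27 2≤n x<30)
... | no  n≮27 = subst (bound x ≤ℤ_) (sym (trans (C-stable 26 n x 26≤n x<30) (C≡fastC 26 x x<30)))
                       (bound≤fastC ℕₚ.≤-refl (s≤s (s≤s z≤n)) x<30)
  where
  26≤n : 26 ≤ n
  26≤n = ℕₚ.≤-trans (ℕₚ.n≤1+n 26) (ℕₚ.≮⇒≥ n≮27)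

LowerBound : ℕ → Set
LowerBound x = ∀ n → 2 ≤ n → bound x ≤ℤ C n x

module LargeArgument (x : ℕ) (30≤x : 30 ≤ x) (ih : ∀ {y} → y < x → LowerBound y) where

  C-step : ∀ m → 4 ℕ.+ m ≤ x → C (suc m) x ≡ C m x + C (suc m) (x ∸ (4 ℕ.+ m))
  C-step m 4+m≤x = trans (peel (C-peels m) x) (cong (C m x +_) (shift-≤ (C (suc m)) 4+m≤x))

  telescope : ∀ k n y → (3 ℕ.+ n) ℕ.+ y ≡ x → k < n → C (n ∸ k) x + boundSum k y ≤ℤ C n x
  telescope zero    n       y _ _           = ℤₚ.≤-reflexive (ℤₚ.+-identityʳ (C n x))
  telescope (suc k) (suc m) y x≡ (s≤s k<m) = begin
    C (m ∸ k) x + (bound y + boundSum k (suc y))    ≡⟨ rearrange (C (m ∸ k) x) (bound y) (boundSum k (suc y)) ⟩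
    (C (m ∸ k) x + boundSum k (suc y)) + bound y    ≤⟨ ℤₚ.+-mono-≤ (telescope k m (suc y) (trans (ℕₚ.+-suc (3 ℕ.+ m) y) x≡) k<m)
                                                                   (ih y<x (suc m) (s≤s (ℕₚ.≤-trans (s≤s z≤n) k<m))) ⟩
    C m x + C (suc m) y                             ≡⟨ cong (λ z → C m x + C (suc m) z) y≡ ⟨
    C m x + C (suc m) (x ∸ (4 ℕ.+ m))               ≡⟨ C-step m 4+m≤x ⟨
    C (suc m) x                                     ∎
    where
    open ℤₚ.≤-Reasoning
    rearrange : ∀ a b c → a + (b + c) ≡ (a + c) + b
    rearrange = solve-∀
    4+m≤x : 4 ℕ.+ m ≤ x
    4+m≤x = subst (4 ℕ.+ m ≤_) x≡ (ℕₚ.m≤m+n (4 ℕ.+ m) y)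
    y≡ : x ∸ (4 ℕ.+ m) ≡ y
    y≡ = trans (cong (_∸ (4 ℕ.+ m)) (sym x≡)) (ℕₚ.m+n∸m≡n (4 ℕ.+ m) y)
    y<x : y < x
    y<x = subst (y <_) x≡ (ℕₚ.m<n+m y (s≤s z≤n))

  16≤x : 16 ≤ x
  16≤x = ℕₚ.≤-trans (ℕₚ.m≤m+n 16 14) 30≤x

  one≤C₂ : 1ℤ ≤ℤ C 2 x
  one≤C₂ = begin
    0ℤ + 1ℤ                ≤⟨ ℤₚ.+-mono-≤ (C₁-nonneg x 16≤x)
                                           (subst (_≤ℤ C 2 (x ∸ 5)) (bound-one (x ∸ 5) 19≤x∸5) (ih x∸5<x 2 ℕₚ.≤-refl)) ⟩
    C 1 x + C 2 (x ∸ 5)    ≡⟨ C-step 1 5≤x ⟨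
    C 2 x                  ∎
    where
    open ℤₚ.≤-Reasoning
    5≤x : 5 ≤ x
    5≤x = ℕₚ.≤-trans (ℕₚ.m≤m+n 5 25) 30≤x
    19≤x∸5 : 19 ≤ x ∸ 5
    19≤x∸5 = ℕₚ.m+n≤o⇒m≤o∸n 19 (ℕₚ.≤-trans (ℕₚ.m≤m+n 24 6) 30≤x)
    x∸5<x : x ∸ 5 < x
    x∸5<x = ℕₚ.∸-monoʳ-< (s≤s z≤n) 5≤x

  -- Telescoping k = 26 − y steps collects bound y + ⋯ + bound 25, which is positive.
  one≤C-telescoped : ∀ m → (∀ {j} → j < suc m → 2 ≤ j → 1ℤ ≤ℤ C j x) →
                     4 ℕ.+ m ≤ x → x ∸ (4 ℕ.+ m) ≤ 16 → 1ℤ ≤ℤ C (suc m) x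
  one≤C-telescoped m ihn 4+m≤x y≤16 = begin
    1ℤ                                  ≡⟨ ℤₚ.+-identityˡ 1ℤ ⟨
    0ℤ + 1ℤ                             ≤⟨ ℤₚ.+-mono-≤ (C-nonneg (suc m ∸ k) (ℕₚ.m<n⇒0<n∸m (s≤s k≤m))
                                                                 (ℕₚ.∸-monoʳ-< 0<k (ℕₚ.m≤n⇒m≤1+n k≤m)))
                                                       (boundSum-pos (s≤s y≤16)) ⟩
    C (suc m ∸ k) x + boundSum k y      ≤⟨ telescope k (suc m) y (ℕₚ.m+[n∸m]≡n 4+m≤x) (s≤s k≤m) ⟩
    C (suc m) x                         ∎
    where
    open ℤₚ.≤-Reasoning
    y : ℕ
    y = x ∸ (4 ℕ.+ m)
    k : ℕ
    k = 26 ∸ y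
    k≤m : k ≤ m
    k≤m = ℕₚ.m≤n+o⇒m∸n≤o 26 y (ℕₚ.+-cancelˡ-≤ 4 26 (y ℕ.+ m)
            (subst (30 ≤_) (trans (sym (ℕₚ.m+[n∸m]≡n 4+m≤x)) (cong (4 ℕ.+_) (ℕₚ.+-comm m y))) 30≤x))
    0<k : 0 < k
    0<k = ℕₚ.m<n⇒0<n∸m (s≤s (ℕₚ.≤-trans y≤16 (ℕₚ.m≤m+n 16 9)))
    C-nonneg : ∀ j → 0 < j → j < suc m → 0ℤ ≤ℤ C j x
    C-nonneg 1               _ _   = C₁-nonneg x 16≤x
    C-nonneg (suc j@(suc _)) _ j<n = ℤₚ.≤-trans (ℤ.+≤+ z≤n) (ihn j<n (s≤s (s≤s z≤n)))

  one≤C : ∀ n → 2 ≤ n → 1ℤ ≤ℤ C n x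
  one≤C = <-rec (λ n → 2 ≤ n → 1ℤ ≤ℤ C n x) step
    where
    step : ∀ n → (∀ {m} → m < n → 2 ≤ m → 1ℤ ≤ℤ C m x) → 2 ≤ n → 1ℤ ≤ℤ C n x
    step 1 _ (s≤s ())
    step 2 _ _ = one≤C₂
    step (suc m@(suc (suc _))) ihn _ with 4 ℕ.+ m ≤? x
    ... | no 4+m≰x = subst (1ℤ ≤ℤ_) (sym (peels-below (C-peels m) (ℕₚ.≰⇒> 4+m≰x))) (ihn ℕₚ.≤-refl (s≤s (s≤s z≤n)))
    ... | yes 4+m≤x with 17 ≤? x ∸ (4 ℕ.+ m)
    ...   | no 17≰y  = one≤C-telescoped m ihn 4+m≤x (ℕₚ.≤-pred (ℕₚ.≰⇒> 17≰y))
    ...   | yes 17≤y = begin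
      1ℤ + 0ℤ              ≤⟨ ℤₚ.+-mono-≤ (ihn ℕₚ.≤-refl (s≤s (s≤s z≤n)))
                                          (ℤₚ.≤-trans (bound-nonneg y 17≤y) (ih y<x (suc m) (s≤s (s≤s z≤n)))) ⟩
      C m x + C (suc m) y  ≡⟨ C-step m 4+m≤x ⟨
      C (suc m) x          ∎
      where
      open ℤₚ.≤-Reasoning
      y : ℕ
      y = x ∸ (4 ℕ.+ m)
      y<x : y < x
      y<x = ℕₚ.∸-monoʳ-< (s≤s z≤n) 4+m≤x

bound≤C : ∀ x → LowerBound x
bound≤C = <-rec LowerBound step
  where
  step : ∀ x → (∀ {y} → y < x → LowerBound y) → LowerBound x
  step x ih n 2≤n with x <? 30
  ... | yes x<30 = bound≤C-small x n x<30 2≤n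
  ... | no  x≮30 = subst (_≤ℤ C n x) (sym (bound-one x (ℕₚ.≤-trans (ℕₚ.m≤m+n 19 11) 30≤x)))
                         (LargeArgument.one≤C x 30≤x ih n 2≤n)
    where
    30≤x : 30 ≤ x
    30≤x = ℕₚ.≮⇒≥ x≮30

module CoefficientBound (r : ℕ) where

  F : PS
  F = invPoch 3 (22 ℕ.+ r)

  Y : PS
  Y = invPoch 4 (22 ℕ.+ r)

  Q : PS
  Q = invPoch 4 (21 ℕ.+ r)

  M : ℕ
  M = 4 ℕ.+ (21 ℕ.+ r)

  F-peel : Peels 3 F Q
  F-peel = invPoch-peel-first 2 (21 ℕ.+ r)

  Y-peel : Peels M Y Q
  Y-peel = invPoch-peel-last 3 (21 ℕ.+ r)

  F-step : ∀ k → F (3 ℕ.+ k) ≡ Q (3 ℕ.+ k) + F k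
  F-step k = trans (peel F-peel (3 ℕ.+ k))
    (cong (Q (3 ℕ.+ k) +_) (trans (shift-≤ F (ℕₚ.m≤m+n 3 k)) (cong F (ℕₚ.m+n∸m≡n 3 k))))

  F-nonneg : ∀ k → 0ℤ ≤ℤ F k
  F-nonneg = invPoch-nonneg 2 (22 ℕ.+ r)

  -- The step 4 + r = L − 18 of the second monotonicity estimate is where L ≥ 22 is needed.
  twice-Y≤F : ∀ n → Y n + Y n ≤ℤ F ((7 ℕ.+ r) ℕ.+ n)
  twice-Y≤F = <-rec (λ n → Y n + Y n ≤ℤ F ((7 ℕ.+ r) ℕ.+ n)) step
    where
    tail≤ : ∀ n → (∀ {m} → m < n → Y m + Y m ≤ℤ F ((7 ℕ.+ r) ℕ.+ m)) →
            shift M Y n + shift M Y n ≤ℤ F ((1 ℕ.+ r) ℕ.+ n)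
    tail≤ n ih with M ≤? n
    ... | no _ = F-nonneg _
    ... | yes M≤n = begin
      Y (n ∸ M) + Y (n ∸ M)                           ≤⟨ ih (ℕₚ.∸-monoʳ-< (s≤s z≤n) M≤n) ⟩
      F ((7 ℕ.+ r) ℕ.+ (n ∸ M))                       ≤⟨ invPoch-mono-step 2 (22 ℕ.+ r) (16 ℕ.+ r) _ (ℕₚ.+-monoˡ-< r (ℕₚ.m<m+n 16 {6} (s≤s z≤n))) ⟩
      F ((3 ℕ.+ (16 ℕ.+ r)) ℕ.+ ((7 ℕ.+ r) ℕ.+ (n ∸ M))) ≡⟨ cong F (trans (arith r (n ∸ M)) (cong ((1 ℕ.+ r) ℕ.+_) (ℕₚ.m+[n∸m]≡n M≤n))) ⟩
      F ((1 ℕ.+ r) ℕ.+ n)                             ∎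
      where
      open ℤₚ.≤-Reasoning
      arith : ∀ r m → (3 ℕ.+ (16 ℕ.+ r)) ℕ.+ ((7 ℕ.+ r) ℕ.+ m) ≡ (1 ℕ.+ r) ℕ.+ ((4 ℕ.+ (21 ℕ.+ r)) ℕ.+ m)
      arith = ℕ-Solver.solve-∀
    step : ∀ n → (∀ {m} → m < n → Y m + Y m ≤ℤ F ((7 ℕ.+ r) ℕ.+ m)) → Y n + Y n ≤ℤ F ((7 ℕ.+ r) ℕ.+ n)
    step n ih = begin
      Y n + Y n
        ≡⟨ cong₂ _+_ (peel Y-peel n) (peel Y-peel n) ⟩
      (Q n + shift M Y n) + (Q n + shift M Y n)
        ≡⟨ interchange (Q n) (shift M Y n) (Q n) (shift M Y n) ⟩
      (Q n + Q n) + (shift M Y n + shift M Y n)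
        ≤⟨ ℤₚ.+-mono-≤ (ℤₚ.+-mono-≤ (invPoch-mono-step 3 (21 ℕ.+ r) (3 ℕ.+ r) n (ℕₚ.+-monoˡ-< r (ℕₚ.m<m+n 3 {18} (s≤s z≤n))))
                                    (invPoch-mono-step 3 (21 ℕ.+ r) r n (ℕₚ.m<n+m r (s≤s z≤n))))
                       (tail≤ n ih) ⟩
      (Q ((7 ℕ.+ r) ℕ.+ n) + Q ((4 ℕ.+ r) ℕ.+ n)) + F ((1 ℕ.+ r) ℕ.+ n)
        ≡⟨ ℤₚ.+-assoc (Q ((7 ℕ.+ r) ℕ.+ n)) _ _ ⟩
      Q ((7 ℕ.+ r) ℕ.+ n) + (Q ((4 ℕ.+ r) ℕ.+ n) + F ((1 ℕ.+ r) ℕ.+ n))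
        ≡⟨ trans (F-step ((4 ℕ.+ r) ℕ.+ n)) (cong (Q ((7 ℕ.+ r) ℕ.+ n) +_) (F-step ((1 ℕ.+ r) ℕ.+ n))) ⟨
      F ((7 ℕ.+ r) ℕ.+ n) ∎
      where
      open ℤₚ.≤-Reasoning
      interchange : ∀ a b c d → (a + b) + (c + d) ≡ (a + c) + (b + d)
      interchange = solve-∀

  shift-twice-Y≤shift-F : ∀ x → shift M Y x + shift M Y x ≤ℤ shift 18 F x
  shift-twice-Y≤shift-F x with M ≤? x
  ... | no  _   = shift-nonneg 18 F x (s≤s z≤n) (λ y _ → F-nonneg y)
  ... | yes M≤x = subst (Y (x ∸ M) + Y (x ∸ M) ≤ℤ_) (trans (cong F x-18≡) (sym (shift-≤ F 18≤x)))
                        (twice-Y≤F (x ∸ M))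
    where
    18≤x : 18 ≤ x
    18≤x = ℕₚ.≤-trans (ℕₚ.m≤m+n 18 (7 ℕ.+ r)) M≤x
    x-18≡ : (7 ℕ.+ r) ℕ.+ (x ∸ M) ≡ x ∸ 18
    x-18≡ = trans (sym (ℕₚ.m+n∸m≡n 18 _)) (cong (_∸ 18) (ℕₚ.m+[n∸m]≡n M≤x))

  shift-F-step : ∀ c x → shift c F x ≡ shift c Q x + shift (3 ℕ.+ c) F x
  shift-F-step c x = trans (peel (peels-shift c F-peel) x) (cong (shift c Q x +_) (shift-shift c 3 F x))

  F-expand : ∀ x → F x ≡ Q x + (shift 3 Q x + (shift 6 Q x + (shift 9 Q x + (shift 12 Q x + (shift 15 Q x + shift 18 F x)))))
  F-expand x =
    trans (peel F-peel x) (cong (Q x +_)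
    (trans (shift-F-step 3 x) (cong (shift 3 Q x +_)
    (trans (shift-F-step 6 x) (cong (shift 6 Q x +_)
    (trans (shift-F-step 9 x) (cong (shift 9 Q x +_)
    (trans (shift-F-step 12 x) (cong (shift 12 Q x +_) (shift-F-step 15 x))))))))))

  F-minus-twice-Y : ∀ x → F x - (Y x + Y x) ≡ C (21 ℕ.+ r) x + (shift 18 F x - (shift M Y x + shift M Y x))
  F-minus-twice-Y x = trans (cong₂ (λ f y → f - (y + y)) (F-expand x) (peel Y-peel x))
                      (regroup (Q x) (shift 3 Q x) (shift 6 Q x) (shift 9 Q x) (shift 12 Q x) (shift 15 Q x)
                               (shift 18 F x) (shift M Y x))
    where
    regroup : ∀ q q₃ q₆ q₉ q₁₂ q₁₅ f a →
      (q + (q₃ + (q₆ + (q₉ + (q₁₂ + (q₁₅ + f)))))) - ((q + a) + (q + a))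
      ≡ (((((q₃ + q₆) + q₉) + q₁₂) + q₁₅) - q) + (f - (a + a))
    regroup = solve-∀

  bound≤F-minus-twice-Y : ∀ x → bound x ≤ℤ F x - (Y x + Y x)
  bound≤F-minus-twice-Y x = subst₂ _≤ℤ_ (ℤₚ.+-identityʳ (bound x)) (sym (F-minus-twice-Y x))
    (ℤₚ.+-mono-≤ (bound≤C x (21 ℕ.+ r) (s≤s (s≤s z≤n))) (ℤₚ.i≤j⇒0≤j-i (shift-twice-Y≤shift-F x)))

bound≤H : ∀ L N → 22 ≤ L → bound (suc N) ≤ℤ H L 3 L (suc N)
bound≤H L N 22≤L = subst (λ L → bound (suc N) ≤ℤ H L 3 L (suc N)) (ℕₚ.m+[n∸m]≡n 22≤L)
  (subst (bound (suc N) ≤ℤ_) (sym (H-coeff (22 ℕ.+ (L ∸ 22)) 3 N (s≤s z≤n)))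
         (CoefficientBound.bound≤F-minus-twice-Y (L ∸ 22) (suc N)))

lemma15 : (L N : ℕ) → 22 ≤ L → 21 ≤ N → 0ℤ <ℤ H L 3 L N
lemma15 L (suc N) 22≤L 21≤N = ℤₚ.<-≤-trans (ℤ.+<+ (s≤s z≤n))
  (subst (_≤ℤ H L 3 L (suc N)) (bound-one (suc N) (ℕₚ.≤-trans (ℕₚ.m≤m+n 19 2) 21≤N)) (bound≤H L N 22≤L))
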